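{- There are infinitely many pairwise non-equivalent pairs of linked extraordinary forms in $\mathrm{Bin}(3,\mathbb{Q})$.
   Context: $\mathrm{Bin}(3,\mathbb{Q})$ is the set of binary cubic forms with rational coefficients and nonzero discriminant. For $\gamma=\begin{pmatrix} a&b\\ c&e\end{pmatrix}$, $(F\circ\gamma)(X,Y)=F(aX+bY,cX+eY)$, and $F(\mathbb{Z}^2)=\{F(x,y):(x,y)\in\mathbb{Z}^2\}$. A pair $(F,G)$ of forms in $\mathrm{Bin}(3,\mathbb{Q})$ is a pair of linked extraordinary forms if $G(\mathbb{Z}^2)=F(\mathbb{Z}^2)$ and there is no $\gamma\in\mathrm{GL}(2,\mathbb{Z})$ with $G=F\circ\gamma$. Two such pairs $(F,G)$ and $(F',G')$ are equivalent if there exist $a\in\mathbb{Q}^*$ and $\gamma,\delta\in\mathrm{GL}(2,\mathbb{Z})$ with $F'=a\,F\circ\gamma$ and $G'=a\,G\circ\delta$. -}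

module Defs where

open import Data.Integer as ℤ using (ℤ; +_)
open import Data.Rational using (ℚ; _+_; _*_; _-_; _/_; 0ℚ)
open import Data.Product using (Σ; ∃; _×_; _,_)
open import Data.Sum using (_⊎_)
open import Data.Nat using (ℕ)
open import Relation.Binary.PropositionalEquality using (_≡_; _≢_)
open import Relation.Nullary using (¬_)

⟦_⟧ : ℤ → ℚ
⟦ z ⟧ = z / 1

-- A binary cubic form  F(X,Y) = a X³ + b X²Y + c XY² + d Y³  with rational coefficients
record Cubic : Set where
  constructor cubic
  field
    a b c d : ℚ
open Cubic public

eval : Cubic → ℚ → ℚ → ℚ
eval (cubic a b c d) x y =
  a * (x * x * x) + b * (x * x * y) + c * (x * y * y) + d * (y * y * y)

disc : Cubic → ℚ
disc (cubic a b c d) =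
  b * b * c * c - (+ 4 / 1) * a * c * c * c - (+ 4 / 1) * b * b * b * d
  - (+ 27 / 1) * a * a * d * d + (+ 18 / 1) * a * b * c * d

IsBin3 : Cubic → Set
IsBin3 F = disc F ≢ 0ℚ

record Mat2 : Set where
  constructor mat
  field
    p q r s : ℤ
open Mat2 public

det : Mat2 → ℤ
det (mat p q r s) = p ℤ.* s ℤ.- q ℤ.* r

InGL2Z : Mat2 → Set
InGL2Z γ = (det γ ≡ + 1) ⊎ (det γ ≡ ℤ.- (+ 1))

-- (F ∘ γ)(X,Y) = F(pX + qY, rX + sY), computed coefficientwise
_∘ₘ_ : Cubic → Mat2 → Cubic
cubic A B C D ∘ₘ mat p' q' r' s' =
  let a = ⟦ p' ⟧ ; b = ⟦ q' ⟧ ; c = ⟦ r' ⟧ ; e = ⟦ s' ⟧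
      three = + 3 / 1 ; two = + 2 / 1
  in cubic
    (A * (a * a * a) + B * (a * a * c) + C * (a * c * c) + D * (c * c * c))
    (A * (three * a * a * b) + B * (a * a * e + two * a * b * c)
       + C * (two * a * c * e + b * c * c) + D * (three * c * c * e))
    (A * (three * a * b * b) + B * (two * a * b * e + b * b * c)
       + C * (a * e * e + two * b * c * e) + D * (three * c * e * e))
    (A * (b * b * b) + B * (b * b * e) + C * (b * e * e) + D * (e * e * e))

_·_ : ℚ → Cubic → Cubic
k · cubic a b c d = cubic (k * a) (k * b) (k * c) (k * d)

ValuesIn : Cubic → Cubic → Set
ValuesIn F G = ∀ (x y : ℤ) → ∃ λ (u : ℤ) → ∃ λ (v : ℤ) → eval G ⟦ u ⟧ ⟦ v ⟧ ≡ eval F ⟦ x ⟧ ⟦ y ⟧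

SameValues : Cubic → Cubic → Set
SameValues F G = ValuesIn F G × ValuesIn G F

LinkedExtraordinary : Cubic → Cubic → Set
LinkedExtraordinary F G =
  IsBin3 F × IsBin3 G × SameValues F G
  × ¬ (∃ λ (γ : Mat2) → InGL2Z γ × G ≡ F ∘ₘ γ)

PairEquiv : Cubic × Cubic → Cubic × Cubic → Set
PairEquiv (F , G) (F' , G') =
  ∃ λ (k : ℚ) → ∃ λ (γ : Mat2) → ∃ λ (δ : Mat2) →
    k ≢ 0ℚ × InGL2Z γ × InGL2Z δ × F' ≡ k · (F ∘ₘ γ) × G' ≡ k · (G ∘ₘ δ)

{-# OPTIONS --safe #-}
module Submission where

-- The pairs are Shanks' simplest cubics F_t = X³ + tX²Y − (t + 3)XY² + Y³, of discriminant
-- (t² + 3t + 9)², together with G_t(X, Y) = F_t(2X, Y), for t ∈ ℕ.  The substitution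
-- σ(x, y) = (−y, x − y) preserves F_t and permutes the three nonzero classes of (ℤ/2)²
-- cyclically, so every value of F_t is taken at a point with even first coordinate, that is,
-- it is a value of G_t.  F_t is odd at every point outside 2ℤ², while G_t(1, 0) = 8 would be
-- F_t(p, r) for the first column (p, r) of any γ ∈ GL(2, ℤ) with G_t = F_t ∘ γ; so the forms
-- are not equivalent.  Finally, if F_n = k · F_m ∘ γ then k⁻¹ = F_m(p, r) and
-- k = ±F_n(s, −r) are both integers, so k = ±1, and the invariance
-- disc (F ∘ γ) = det(γ)⁶ disc F gives (m² + 3m + 9)² = (n² + 3n + 9)², hence m = n.

open import Defs hiding (eval; disc; _·_; a; b; c; d)
import Defs
open import Data.Nat using (ℕ)
open import Data.Product using (∃; _×_; proj₁; proj₂)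
open import Relation.Binary.PropositionalEquality using (_≢_)
open import Relation.Nullary using (¬_)

open import Level using (0ℓ)
open import Algebra.Bundles using (CommutativeMonoid)
open import Algebra.Bundles.Raw using (RawRing)
import Algebra.Properties.CommutativeSemigroup as CommutativeSemigroupProperties
import Data.Nat as ℕ
import Data.Nat.Properties as ℕ
import Data.Nat.Coprimality as Coprime
import Data.Integer as ℤ
open import Data.Integer using (ℤ; +_; 0ℤ; 1ℤ)
open import Data.Integer.Properties
  using ( neg-distribʳ-*; abs-*; pos-*; +-injective; *-identityˡ; *-identityʳ; *-cancelˡ-≡
        ; ^-*-assoc; ^-zeroˡ; i*j≡0⇒i≡0∨j≡0; i^n≡0⇒i≡0)
open import Data.Integer.DivMod using (n%ℕd<d; a≡a%ℕn+[a/ℕn]*n)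
open import Data.Integer.Solver using (module +-*-Solver)
open import Data.Rational as ℚ using (ℚ; mkℚ; ↥_)
import Data.Rational.Properties as ℚ
open import Data.Product using (_,_; ∃-syntax)
open import Data.Sum using (_⊎_; inj₁; inj₂; [_,_]′)
open import Function.Base using (id)
open import Relation.Binary.Definitions using (tri<; tri≈; tri>)
open import Relation.Binary.PropositionalEquality
  using (_≡_; refl; sym; trans; cong; cong₂; subst; module ≡-Reasoning)
open import Relation.Nullary using (contradiction)

-- The formulas of Defs, written once over a ring with integer constants κ.  Over ℤ they are
-- the integral forms used throughout; over Expr they evaluate in ℚ to Defs' own formulas
-- definitionally, which transports rational statements to ℤ; over the solver's polynomials
-- they let `solve` prove identities between them.
module BinaryForms (R : RawRing 0ℓ 0ℓ) (κ : ℤ → RawRing.Carrier R) where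
  open RawRing R

  record Form : Set where
    constructor form
    field c₀ c₁ c₂ c₃ : Carrier
  open Form public

  form-cong : ∀ {a b c d a′ b′ c′ d′} → a ≡ a′ → b ≡ b′ → c ≡ c′ → d ≡ d′ →
              form a b c d ≡ form a′ b′ c′ d′
  form-cong refl refl refl refl = refl

  eval : Form → Carrier → Carrier → Carrier
  eval (form a b c d) x y =
    a * (x * x * x) + b * (x * x * y) + c * (x * y * y) + d * (y * y * y)

  disc : Form → Carrier
  disc (form a b c d) =
    b * b * c * c + - (κ (+ 4) * a * c * c * c) + - (κ (+ 4) * b * b * b * d)
    + - (κ (+ 27) * a * a * d * d) + κ (+ 18) * a * b * c * d

  infixr 7 _·_
  _·_ : Carrier → Form → Form
  k · form a b c d = form (k * a) (k * b) (k * c) (k * d)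

  compose : Form → Carrier → Carrier → Carrier → Carrier → Form
  compose (form A B C D) a b c e =
    let three = κ (+ 3) ; two = κ (+ 2)
    in form
      (A * (a * a * a) + B * (a * a * c) + C * (a * c * c) + D * (c * c * c))
      (A * (three * a * a * b) + B * (a * a * e + two * a * b * c)
         + C * (two * a * c * e + b * c * c) + D * (three * c * c * e))
      (A * (three * a * b * b) + B * (two * a * b * e + b * b * c)
         + C * (a * e * e + two * b * c * e) + D * (three * c * e * e))
      (A * (b * b * b) + B * (b * b * e) + C * (b * e * e) + D * (e * e * e))

  infixl 8 _∘_
  _∘_ : Form → Mat2 → Form
  F ∘ mat p q r s = compose F (κ p) (κ q) (κ r) (κ s)

  record Quadratic : Set where
    constructor quadratic
    field q₀ q₁ q₂ : Carrier
  open Quadratic public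

  quadratic-cong : ∀ {a b c a′ b′ c′} → a ≡ a′ → b ≡ b′ → c ≡ c′ →
                   quadratic a b c ≡ quadratic a′ b′ c′
  quadratic-cong refl refl refl = refl

  qdisc : Quadratic → Carrier
  qdisc (quadratic a b c) = b * b + - (κ (+ 4) * a * c)

  infixr 7 _q·_
  _q·_ : Carrier → Quadratic → Quadratic
  k q· quadratic a b c = quadratic (k * a) (k * b) (k * c)

  qcompose : Quadratic → Carrier → Carrier → Carrier → Carrier → Quadratic
  qcompose (quadratic A B C) a b c e = quadratic
    (A * a * a + B * a * c + C * c * c)
    (κ (+ 2) * A * a * b + B * (a * e + b * c) + κ (+ 2) * C * c * e)
    (A * b * b + B * b * e + C * e * e)

  infixl 8 _q∘_
  _q∘_ : Quadratic → Mat2 → Quadratic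
  Q q∘ mat p q r s = qcompose Q (κ p) (κ q) (κ r) (κ s)

  hessian : Form → Quadratic
  hessian (form a b c d) = quadratic
    (b * b + - (κ (+ 3) * a * c)) (b * c + - (κ (+ 9) * a * d)) (c * c + - (κ (+ 3) * b * d))

  simplest : Carrier → Form
  simplest t = form (κ (+ 1)) t (κ (ℤ.- + 3) + - t) (κ (+ 1))

open BinaryForms ℤ.+-*-rawRing id

-- Imported only now: inside BinaryForms these names are the ring's own operations.
open import Data.Integer using (-[1+_]; _+_; _*_; _-_; -_; _^_; ∣_∣; _%ℕ_; _/ℕ_)
open +-*-Solver using (Polynomial; con; _:+_; _:*_; :-_; _:-_; _:^_; solve; _:=_)

polynomialRing : ℕ → RawRing 0ℓ 0ℓ
polynomialRing n = record
  { Carrier = Polynomial n ; _≈_ = _≡_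
  ; _+_ = _:+_ ; _*_ = _:*_ ; -_ = :-_ ; 0# = con 0ℤ ; 1# = con 1ℤ }

module P {n} = BinaryForms (polynomialRing n) con

-- Parity and units in ℤ

Even Odd : ℤ → Set
Even x = ∃[ h ] x ≡ + 2 * h
Odd  x = ∃[ h ] x ≡ + 2 * h + 1ℤ

parity : ∀ x → Even x ⊎ Odd x
parity x = byRemainder (x %ℕ 2) (n%ℕd<d x 2) (a≡a%ℕn+[a/ℕn]*n x 2)
  where
  byRemainder : ∀ ρ → ρ ℕ.< 2 → x ≡ + ρ + x /ℕ 2 * + 2 → Even x ⊎ Odd x
  byRemainder 0 _ eq = inj₁ (x /ℕ 2 , trans eq
    (solve 1 (λ h → con 0ℤ :+ h :* con (+ 2) := con (+ 2) :* h) refl (x /ℕ 2)))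
  byRemainder 1 _ eq = inj₂ (x /ℕ 2 , trans eq
    (solve 1 (λ h → con 1ℤ :+ h :* con (+ 2) := con (+ 2) :* h :+ con 1ℤ) refl (x /ℕ 2)))
  byRemainder (ℕ.suc (ℕ.suc _)) (ℕ.s≤s (ℕ.s≤s ()))

even⇒¬odd : ∀ {x} → Even x → ¬ Odd x
even⇒¬odd (a , refl) (b , eq) =
  contradiction (ℕ.m*n≡1⇒m≡1 2 ∣ a - b ∣ (trans (sym (abs-* (+ 2) (a - b))) (cong ∣_∣ 2[a-b]≡1)))
                λ ()
  where
  open ≡-Reasoning
  2[a-b]≡1 : + 2 * (a - b) ≡ 1ℤ
  2[a-b]≡1 = begin
    + 2 * (a - b)
      ≡⟨ solve 2 (λ a b → con (+ 2) :* (a :- b) := con (+ 2) :* a :- con (+ 2) :* b) refl a b ⟩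
    + 2 * a - + 2 * b
      ≡⟨ cong (_- + 2 * b) eq ⟩
    + 2 * b + 1ℤ - + 2 * b
      ≡⟨ solve 1 (λ b → con (+ 2) :* b :+ con 1ℤ :- con (+ 2) :* b := con 1ℤ) refl b ⟩
    1ℤ ∎

even-neg : ∀ {x} → Even x → Even (- x)
even-neg (k , refl) = - k , neg-distribʳ-* (+ 2) k

odd-neg : ∀ {x} → Odd x → Odd (- x)
odd-neg (h , refl) =
  - h - 1ℤ ,
  solve 1 (λ h → :- (con (+ 2) :* h :+ con 1ℤ) := con (+ 2) :* (:- h :- con 1ℤ) :+ con 1ℤ) refl h

odd-even-sub : ∀ {x y} → Odd x → Even y → Odd (x - y)
odd-even-sub (h , refl) (k , refl) =
  h - k ,
  solve 2 (λ h k → con (+ 2) :* h :+ con 1ℤ :- con (+ 2) :* k := con (+ 2) :* (h :- k) :+ con 1ℤ)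
    refl h k

odd-odd-sub : ∀ {x y} → Odd x → Odd y → Even (x - y)
odd-odd-sub (h , refl) (k , refl) =
  h - k ,
  solve 2 (λ h k → con (+ 2) :* h :+ con 1ℤ :- (con (+ 2) :* k :+ con 1ℤ) := con (+ 2) :* (h :- k))
    refl h k

-- InGL2Z γ unfolds to IsUnit (det γ).
IsUnit : ℤ → Set
IsUnit u = u ≡ 1ℤ ⊎ u ≡ - 1ℤ

∣u∣≡1⇒IsUnit : ∀ u → ∣ u ∣ ≡ 1 → IsUnit u
∣u∣≡1⇒IsUnit (+ _)    refl = inj₁ refl
∣u∣≡1⇒IsUnit -[1+ _ ] refl = inj₂ refl

IsUnit⇒∣u∣≡1 : ∀ {u} → IsUnit u → ∣ u ∣ ≡ 1
IsUnit⇒∣u∣≡1 (inj₁ refl) = refl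
IsUnit⇒∣u∣≡1 (inj₂ refl) = refl

IsUnit⇒Odd : ∀ {u} → IsUnit u → Odd u
IsUnit⇒Odd (inj₁ refl) = 0ℤ , refl
IsUnit⇒Odd (inj₂ refl) = - 1ℤ , refl

IsUnit-* : ∀ {i j} → IsUnit i → IsUnit j → IsUnit (i * j)
IsUnit-* (inj₁ refl) (inj₁ refl) = inj₁ refl
IsUnit-* (inj₁ refl) (inj₂ refl) = inj₂ refl
IsUnit-* (inj₂ refl) (inj₁ refl) = inj₂ refl
IsUnit-* (inj₂ refl) (inj₂ refl) = inj₁ refl

IsUnit-*⇒IsUnitˡ : ∀ i j → IsUnit (i * j) → IsUnit i
IsUnit-*⇒IsUnitˡ i j unit =
  ∣u∣≡1⇒IsUnit i (ℕ.m*n≡1⇒m≡1 ∣ i ∣ ∣ j ∣ (trans (sym (abs-* i j)) (IsUnit⇒∣u∣≡1 unit)))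

IsUnit-^ : ∀ {u} → IsUnit u → ∀ n → IsUnit (u ^ n)
IsUnit-^ unit ℕ.zero    = inj₁ refl
IsUnit-^ unit (ℕ.suc n) = IsUnit-* unit (IsUnit-^ unit n)

IsUnit-^-even : ∀ {u} → IsUnit u → ∀ n → u ^ (2 ℕ.* n) ≡ 1ℤ
IsUnit-^-even {u} unit n =
  trans (sym (^-*-assoc u 2 n)) (trans (cong (_^ n) (square unit)) (^-zeroˡ n))
  where
  square : IsUnit u → u ^ 2 ≡ 1ℤ
  square (inj₁ refl) = refl
  square (inj₂ refl) = refl

-- Identities between integral forms

eval-∘ : ∀ F γ x y →
  eval (F ∘ γ) x y ≡ eval F (Mat2.p γ * x + Mat2.q γ * y) (Mat2.r γ * x + Mat2.s γ * y)
eval-∘ (form a b c d) (mat p q r s) x y =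
  solve 10 (λ a b c d p q r s x y →
    P.eval (P.compose (P.form a b c d) p q r s) x y
      := P.eval (P.form a b c d) (p :* x :+ q :* y) (r :* x :+ s :* y))
    refl a b c d p q r s x y

eval-∘-adjugate : ∀ F γ → eval (F ∘ γ) (Mat2.s γ) (- Mat2.r γ) ≡ det γ ^ 3 * c₀ F
eval-∘-adjugate (form a b c d) (mat p q r s) =
  solve 8 (λ a b c d p q r s →
    P.eval (P.compose (P.form a b c d) p q r s) s (:- r)
      := (p :* s :- q :* r) :^ 3 :* a)
    refl a b c d p q r s

eval-· : ∀ k F x y → eval (k · F) x y ≡ k * eval F x y
eval-· k (form a b c d) x y =
  solve 7 (λ k a b c d x y → P.eval (k P.· P.form a b c d) x y := k :* P.eval (P.form a b c d) x y)
    refl k a b c d x y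

disc-· : ∀ k F → disc (k · F) ≡ k ^ 4 * disc F
disc-· k (form a b c d) =
  solve 5 (λ k a b c d → P.disc (k P.· P.form a b c d) := k :^ 4 :* P.disc (P.form a b c d))
    refl k a b c d

qdisc-hessian : ∀ F → qdisc (hessian F) ≡ - + 3 * disc F
qdisc-hessian (form a b c d) =
  solve 4 (λ a b c d →
    P.qdisc (P.hessian (P.form a b c d)) := con (- + 3) :* P.disc (P.form a b c d))
    refl a b c d

qdisc-· : ∀ k Q → qdisc (k q· Q) ≡ k * k * qdisc Q
qdisc-· k (quadratic a b c) =
  solve 4 (λ k a b c → P.qdisc (k P.q· P.quadratic a b c) := k :* k :* P.qdisc (P.quadratic a b c))
    refl k a b c

qdisc-∘ : ∀ Q γ → qdisc (Q q∘ γ) ≡ det γ * det γ * qdisc Q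
qdisc-∘ (quadratic a b c) (mat p q r s) =
  solve 7 (λ a b c p q r s →
    P.qdisc (P.qcompose (P.quadratic a b c) p q r s)
      := (p :* s :- q :* r) :* (p :* s :- q :* r) :* P.qdisc (P.quadratic a b c))
    refl a b c p q r s

hessian-∘ : ∀ F γ → hessian (F ∘ γ) ≡ (det γ * det γ) q· (hessian F q∘ γ)
hessian-∘ (form a b c d) (mat p q r s) = quadratic-cong
  (solve 8 (λ a b c d p q r s → P.q₀ (lhs a b c d p q r s) := P.q₀ (rhs a b c d p q r s))
    refl a b c d p q r s)
  (solve 8 (λ a b c d p q r s → P.q₁ (lhs a b c d p q r s) := P.q₁ (rhs a b c d p q r s))
    refl a b c d p q r s)
  (solve 8 (λ a b c d p q r s → P.q₂ (lhs a b c d p q r s) := P.q₂ (rhs a b c d p q r s))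
    refl a b c d p q r s)
  where
  lhs rhs : ∀ {n} (a b c d p q r s : Polynomial n) → P.Quadratic
  lhs a b c d p q r s = P.hessian (P.compose (P.form a b c d) p q r s)
  rhs a b c d p q r s =
    ((p :* s :- q :* r) :* (p :* s :- q :* r)) P.q· P.qcompose (P.hessian (P.form a b c d)) p q r s

-- The Hessian is a quadratic covariant of weight 2 with qdisc (hessian F) = −3 disc F; going
-- through it keeps every polynomial identity small enough for the solver.
disc-∘ : ∀ F γ → disc (F ∘ γ) ≡ det γ ^ 6 * disc F
disc-∘ F γ = *-cancelˡ-≡ (- + 3) _ _ (begin
  - + 3 * disc (F ∘ γ)                        ≡⟨ sym (qdisc-hessian (F ∘ γ)) ⟩
  qdisc (hessian (F ∘ γ))                     ≡⟨ cong qdisc (hessian-∘ F γ) ⟩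
  qdisc (Δ² q· (hessian F q∘ γ))              ≡⟨ qdisc-· Δ² (hessian F q∘ γ) ⟩
  Δ² * Δ² * qdisc (hessian F q∘ γ)            ≡⟨ cong (Δ² * Δ² *_) (qdisc-∘ (hessian F) γ) ⟩
  Δ² * Δ² * (Δ² * qdisc (hessian F))          ≡⟨ cong (λ h → Δ² * Δ² * (Δ² * h)) (qdisc-hessian F) ⟩
  Δ² * Δ² * (Δ² * (- + 3 * disc F))           ≡⟨ collect (det γ) (disc F) ⟩
  - + 3 * (det γ ^ 6 * disc F)                ∎)
  where
  open ≡-Reasoning
  Δ² = det γ * det γ
  collect : ∀ δ D → δ * δ * (δ * δ) * (δ * δ * (- + 3 * D)) ≡ - + 3 * (δ ^ 6 * D)
  collect = solve 2 (λ δ D →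
    δ :* δ :* (δ :* δ) :* (δ :* δ :* (con (- + 3) :* D)) := con (- + 3) :* (δ :^ 6 :* D)) refl

disc-∘≢0 : ∀ F γ → det γ ≢ 0ℤ → disc F ≢ 0ℤ → disc (F ∘ γ) ≢ 0ℤ
disc-∘≢0 F γ det≢0 disc≢0 eq =
  [ (λ det⁶≡0 → det≢0 (i^n≡0⇒i≡0 (det γ) 6 det⁶≡0)) , disc≢0 ]′
    (i*j≡0⇒i≡0∨j≡0 (det γ ^ 6) (trans (sym (disc-∘ F γ)) eq))

eval-even : ∀ F {x y} → Even x → Even y → Even (eval F x y)
eval-even F@(form a b c d) (u , refl) (v , refl) =
  + 4 * eval F u v , solve 6 (λ a b c d u v →
        P.eval (P.form a b c d) (con (+ 2) :* u) (con (+ 2) :* v)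
          := con (+ 2) :* (con (+ 4) :* P.eval (P.form a b c d) u v))
      refl a b c d u v

∘-multiple⇒unit : ∀ F G γ c → c₀ F ≡ 1ℤ → InGL2Z γ → F ∘ γ ≡ c · G → IsUnit c
∘-multiple⇒unit F G γ@(mat p q r s) c c₀F≡1 unit eq =
  IsUnit-*⇒IsUnitˡ c (eval G s (- r)) (subst IsUnit det³≡c*G[s,-r] (IsUnit-^ unit 3))
  where
  open ≡-Reasoning
  det³≡c*G[s,-r] : det γ ^ 3 ≡ c * eval G s (- r)
  det³≡c*G[s,-r] = begin
    det γ ^ 3               ≡⟨ sym (*-identityʳ (det γ ^ 3)) ⟩
    det γ ^ 3 * 1ℤ          ≡⟨ cong (det γ ^ 3 *_) (sym c₀F≡1) ⟩
    det γ ^ 3 * c₀ F        ≡⟨ sym (eval-∘-adjugate F γ) ⟩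
    eval (F ∘ γ) s (- r)    ≡⟨ cong (λ H → eval H s (- r)) eq ⟩
    eval (c · G) s (- r)    ≡⟨ eval-· c G s (- r) ⟩
    c * eval G s (- r)      ∎

disc-unit-equivalence : ∀ F G γ c → InGL2Z γ → IsUnit c → F ∘ γ ≡ c · G → disc F ≡ disc G
disc-unit-equivalence F G γ c unit c-unit eq = begin
  disc F                ≡⟨ sym (*-identityˡ (disc F)) ⟩
  1ℤ * disc F           ≡⟨ cong (_* disc F) (sym (IsUnit-^-even unit 3)) ⟩
  det γ ^ 6 * disc F    ≡⟨ sym (disc-∘ F γ) ⟩
  disc (F ∘ γ)          ≡⟨ cong disc eq ⟩
  disc (c · G)          ≡⟨ disc-· c G ⟩
  c ^ 4 * disc G        ≡⟨ cong (_* disc G) (IsUnit-^-even c-unit 2) ⟩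
  1ℤ * disc G           ≡⟨ *-identityˡ (disc G) ⟩
  disc G                ∎
  where open ≡-Reasoning

-- Integral forms inside Bin(3, ℚ)

-- ⟦ z ⟧ in normal form: on denominators 1, ℚ's + and * reduce to those of ℤ.
mkℚ-int : ℤ → ℚ
mkℚ-int z = mkℚ z 0 (Coprime.sym (Coprime.1-coprimeTo ∣ z ∣))

⟦⟧-mkℚ : ∀ z → ⟦ z ⟧ ≡ mkℚ-int z
⟦⟧-mkℚ z = ℚ.↥p/↧p≡p (mkℚ-int z)

⟦⟧-homo-+ : ∀ x y → ⟦ x + y ⟧ ≡ ⟦ x ⟧ ℚ.+ ⟦ y ⟧
⟦⟧-homo-+ x y = begin
  ⟦ x + y ⟧            ≡⟨ cong₂ (λ u v → ⟦ u + v ⟧) (sym (*-identityʳ x)) (sym (*-identityʳ y)) ⟩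
  ⟦ x * 1ℤ + y * 1ℤ ⟧  ≡⟨ sym (cong₂ ℚ._+_ (⟦⟧-mkℚ x) (⟦⟧-mkℚ y)) ⟩
  ⟦ x ⟧ ℚ.+ ⟦ y ⟧      ∎
  where open ≡-Reasoning

⟦⟧-homo-* : ∀ x y → ⟦ x * y ⟧ ≡ ⟦ x ⟧ ℚ.* ⟦ y ⟧
⟦⟧-homo-* x y = sym (cong₂ ℚ._*_ (⟦⟧-mkℚ x) (⟦⟧-mkℚ y))

⟦⟧-homo‿- : ∀ x → ⟦ - x ⟧ ≡ ℚ.- ⟦ x ⟧
⟦⟧-homo‿- x = trans (⟦⟧-mkℚ (- x)) (trans (mkℚ-neg x) (cong ℚ.-_ (sym (⟦⟧-mkℚ x))))
  where
  mkℚ-neg : ∀ x → mkℚ-int (- x) ≡ ℚ.- mkℚ-int x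
  mkℚ-neg (+ 0)      = refl
  mkℚ-neg (+ ℕ.suc n) = refl
  mkℚ-neg -[1+ n ]   = refl

⟦⟧-injective : ∀ {x y} → ⟦ x ⟧ ≡ ⟦ y ⟧ → x ≡ y
⟦⟧-injective {x} {y} eq = cong ↥_ (trans (sym (⟦⟧-mkℚ x)) (trans eq (⟦⟧-mkℚ y)))

infixl 6 _⊕_
infixl 7 _⊗_
infix 8 ⊝_
data Expr : Set where
  lit     : ℤ → Expr
  _⊕_ _⊗_ : Expr → Expr → Expr
  ⊝_      : Expr → Expr

exprRing : RawRing 0ℓ 0ℓ
exprRing = record
  { Carrier = Expr ; _≈_ = _≡_
  ; _+_ = _⊕_ ; _*_ = _⊗_ ; -_ = ⊝_ ; 0# = lit 0ℤ ; 1# = lit 1ℤ }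

module E = BinaryForms exprRing lit

⟦_⟧ℤ : Expr → ℤ
⟦ lit z ⟧ℤ = z
⟦ e ⊕ f ⟧ℤ = ⟦ e ⟧ℤ + ⟦ f ⟧ℤ
⟦ e ⊗ f ⟧ℤ = ⟦ e ⟧ℤ * ⟦ f ⟧ℤ
⟦ ⊝ e ⟧ℤ   = - ⟦ e ⟧ℤ

⟦_⟧ℚ : Expr → ℚ
⟦ lit z ⟧ℚ = ⟦ z ⟧
⟦ e ⊕ f ⟧ℚ = ⟦ e ⟧ℚ ℚ.+ ⟦ f ⟧ℚ
⟦ e ⊗ f ⟧ℚ = ⟦ e ⟧ℚ ℚ.* ⟦ f ⟧ℚ
⟦ ⊝ e ⟧ℚ   = ℚ.- ⟦ e ⟧ℚ

⟦⟧ℚ≡⟦⟦⟧ℤ⟧ : ∀ e → ⟦ e ⟧ℚ ≡ ⟦ ⟦ e ⟧ℤ ⟧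
⟦⟧ℚ≡⟦⟦⟧ℤ⟧ (lit z) = refl
⟦⟧ℚ≡⟦⟦⟧ℤ⟧ (e ⊕ f) =
  trans (cong₂ ℚ._+_ (⟦⟧ℚ≡⟦⟦⟧ℤ⟧ e) (⟦⟧ℚ≡⟦⟦⟧ℤ⟧ f)) (sym (⟦⟧-homo-+ ⟦ e ⟧ℤ ⟦ f ⟧ℤ))
⟦⟧ℚ≡⟦⟦⟧ℤ⟧ (e ⊗ f) =
  trans (cong₂ ℚ._*_ (⟦⟧ℚ≡⟦⟦⟧ℤ⟧ e) (⟦⟧ℚ≡⟦⟦⟧ℤ⟧ f)) (sym (⟦⟧-homo-* ⟦ e ⟧ℤ ⟦ f ⟧ℤ))
⟦⟧ℚ≡⟦⟦⟧ℤ⟧ (⊝ e) = trans (cong ℚ.-_ (⟦⟧ℚ≡⟦⟦⟧ℤ⟧ e)) (sym (⟦⟧-homo‿- ⟦ e ⟧ℤ))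

ι : Form → Cubic
ι (form a b c d) = cubic ⟦ a ⟧ ⟦ b ⟧ ⟦ c ⟧ ⟦ d ⟧

literal : Form → E.Form
literal (form a b c d) = E.form (lit a) (lit b) (lit c) (lit d)

eval-ι : ∀ F x y → Defs.eval (ι F) ⟦ x ⟧ ⟦ y ⟧ ≡ ⟦ eval F x y ⟧
eval-ι F@(form _ _ _ _) x y = ⟦⟧ℚ≡⟦⟦⟧ℤ⟧ (E.eval (literal F) (lit x) (lit y))

disc-ι : ∀ F → Defs.disc (ι F) ≡ ⟦ disc F ⟧
disc-ι F@(form _ _ _ _) = ⟦⟧ℚ≡⟦⟦⟧ℤ⟧ (E.disc (literal F))

ι-∘ : ∀ F γ → ι F ∘ₘ γ ≡ ι (F ∘ γ)
ι-∘ F@(form _ _ _ _) γ@(mat _ _ _ _) = coefficientwise (literal F E.∘ γ)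
  where
  coefficientwise : ∀ G → cubic ⟦ E.c₀ G ⟧ℚ ⟦ E.c₁ G ⟧ℚ ⟦ E.c₂ G ⟧ℚ ⟦ E.c₃ G ⟧ℚ
                        ≡ cubic ⟦ ⟦ E.c₀ G ⟧ℤ ⟧ ⟦ ⟦ E.c₁ G ⟧ℤ ⟧ ⟦ ⟦ E.c₂ G ⟧ℤ ⟧ ⟦ ⟦ E.c₃ G ⟧ℤ ⟧
  coefficientwise (E.form a b c d)
    rewrite ⟦⟧ℚ≡⟦⟦⟧ℤ⟧ a | ⟦⟧ℚ≡⟦⟦⟧ℤ⟧ b | ⟦⟧ℚ≡⟦⟦⟧ℤ⟧ c | ⟦⟧ℚ≡⟦⟦⟧ℤ⟧ d = refl

ι-injective : ∀ {F G} → ι F ≡ ι G → F ≡ G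
ι-injective {form _ _ _ _} {form _ _ _ _} eq = form-cong
  (⟦⟧-injective (cong Cubic.a eq)) (⟦⟧-injective (cong Cubic.b eq))
  (⟦⟧-injective (cong Cubic.c eq)) (⟦⟧-injective (cong Cubic.d eq))

ι-IsBin3 : ∀ F → disc F ≢ 0ℤ → IsBin3 (ι F)
ι-IsBin3 F disc≢0 eq = disc≢0 (⟦⟧-injective (trans (sym (disc-ι F)) eq))

ValuesInℤ : Form → Form → Set
ValuesInℤ F G = ∀ x y → ∃[ u ] ∃[ v ] eval G u v ≡ eval F x y

ι-ValuesIn : ∀ F G → ValuesInℤ F G → ValuesIn (ι F) (ι G)
ι-ValuesIn F G values x y =
  let u , v , eq = values x y
  in u , v , trans (eval-ι G u v) (trans (cong ⟦_⟧ eq) (sym (eval-ι F x y)))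

∘-ValuesIn : ∀ F γ → ValuesInℤ (F ∘ γ) F
∘-ValuesIn F γ@(mat p q r s) x y = p * x + q * y , r * x + s * y , sym (eval-∘ F γ x y)

rescale : ∀ k u v w → ⟦ 1ℤ ⟧ ≡ k ℚ.* ⟦ u ⟧ → ⟦ w ⟧ ≡ k ℚ.* ⟦ v ⟧ → v ≡ u * w
rescale k u v w one eq = ⟦⟧-injective (begin
  ⟦ v ⟧                       ≡⟨ sym (ℚ.*-identityʳ ⟦ v ⟧) ⟩
  ⟦ v ⟧ ℚ.* ⟦ 1ℤ ⟧            ≡⟨ cong (⟦ v ⟧ ℚ.*_) one ⟩
  ⟦ v ⟧ ℚ.* (k ℚ.* ⟦ u ⟧)     ≡⟨ x∙yz≈z∙yx ⟦ v ⟧ k ⟦ u ⟧ ⟩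
  ⟦ u ⟧ ℚ.* (k ℚ.* ⟦ v ⟧)     ≡⟨ cong (⟦ u ⟧ ℚ.*_) (sym eq) ⟩
  ⟦ u ⟧ ℚ.* ⟦ w ⟧             ≡⟨ sym (⟦⟧-homo-* u w) ⟩
  ⟦ u * w ⟧                   ∎)
  where
  open ≡-Reasoning
  open CommutativeSemigroupProperties
    (CommutativeMonoid.commutativeSemigroup ℚ.*-1-commutativeMonoid)

integral-multiple : ∀ {F G k} → ι F ≡ k Defs.· ι G → c₀ F ≡ 1ℤ → G ≡ c₀ G · F
integral-multiple {form _ f₁ f₂ f₃} {form g₀ g₁ g₂ g₃} {k} eq refl = form-cong
  (rescale′ g₀ 1ℤ (cong Cubic.a eq)) (rescale′ g₁ f₁ (cong Cubic.b eq))
  (rescale′ g₂ f₂ (cong Cubic.c eq)) (rescale′ g₃ f₃ (cong Cubic.d eq))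
  where
  rescale′ : ∀ v w → ⟦ w ⟧ ≡ k ℚ.* ⟦ v ⟧ → v ≡ g₀ * w
  rescale′ v w = rescale k g₀ v w (cong Cubic.a eq)

-- The simplest cubics

δ : ℕ → ℕ
δ n = 9 ℕ.+ 3 ℕ.* n ℕ.+ n ℕ.* n

disc-simplest : ∀ n → disc (simplest (+ n)) ≡ + (δ n ℕ.* δ n)
disc-simplest n = begin
  disc (simplest (+ n))
    ≡⟨ solve 1 (λ t → P.disc (P.simplest t) := D t :* D t) refl (+ n) ⟩
  (+ 9 + + 3 * + n + + n * + n) * (+ 9 + + 3 * + n + + n * + n)
    ≡⟨ cong (λ z → z * z) (cong₂ (λ u v → + 9 + u + v) (sym (pos-* 3 n)) (sym (pos-* n n))) ⟩
  + δ n * + δ n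
    ≡⟨ sym (pos-* (δ n) (δ n)) ⟩
  + (δ n ℕ.* δ n) ∎
  where
  open ≡-Reasoning
  D : Polynomial 1 → Polynomial 1
  D t = con (+ 9) :+ con (+ 3) :* t :+ t :* t

disc-simplest≢0 : ∀ n → disc (simplest (+ n)) ≢ 0ℤ
disc-simplest≢0 n eq with trans (sym (disc-simplest n)) eq
... | ()

simplest-σ : ∀ t x y → eval (simplest t) (- y) (x - y) ≡ eval (simplest t) x y
simplest-σ t x y =
  solve 3 (λ t x y → P.eval (P.simplest t) (:- y) (x :- y) := P.eval (P.simplest t) x y) refl t x y

simplest-σ² : ∀ t x y → eval (simplest t) (y - x) (- x) ≡ eval (simplest t) x y
simplest-σ² t x y =
  solve 3 (λ t x y → P.eval (P.simplest t) (y :- x) (:- x) := P.eval (P.simplest t) x y) refl t x y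

simplest-odd : ∀ t {x y} → Even x → Odd y → Odd (eval (simplest t) x y)
simplest-odd t (u , refl) (k , refl) =
  u * (+ 4 * u * u + + 2 * t * u * v - (t + + 3) * v * v) + k * (v * v + v + 1ℤ) ,
  solve 3 (λ t u k → let v = con (+ 2) :* k :+ con 1ℤ in
    P.eval (P.simplest t) (con (+ 2) :* u) v
      := con (+ 2) :* ( u :* (con (+ 4) :* u :* u :+ con (+ 2) :* t :* u :* v
                               :- (t :+ con (+ 3)) :* v :* v)
                       :+ k :* (v :* v :+ v :+ con 1ℤ))
         :+ con 1ℤ)
    refl t u k
  where v = + 2 * k + 1ℤ

simplest-even-first : ∀ t x y → ∃[ x′ ] ∃[ y′ ]
  Even x′ × (Even x × Even y ⊎ Odd y′) × eval (simplest t) x′ y′ ≡ eval (simplest t) x y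
simplest-even-first t x y with parity x | parity y
... | inj₁ ex | inj₁ ey = x , y , ex , inj₁ (ex , ey) , refl
... | inj₁ ex | inj₂ oy = x , y , ex , inj₂ oy , refl
... | inj₂ ox | inj₁ ey = - y , x - y , even-neg ey , inj₂ (odd-even-sub ox ey) , simplest-σ t x y
... | inj₂ ox | inj₂ oy = y - x , - x , odd-odd-sub oy ox , inj₂ (odd-neg ox) , simplest-σ² t x y

doubleX : Mat2
doubleX = mat (+ 2) 0ℤ 0ℤ (+ 1)

eval-∘-doubleX : ∀ F u v → eval (F ∘ doubleX) u v ≡ eval F (+ 2 * u) v
eval-∘-doubleX (form a b c d) u v =
  solve 6 (λ a b c d u v →
    P.eval (P.compose (P.form a b c d) (con (+ 2)) (con 0ℤ) (con 0ℤ) (con 1ℤ)) u v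
      := P.eval (P.form a b c d) (con (+ 2) :* u) v)
    refl a b c d u v

simplest-ValuesIn-doubled : ∀ t → ValuesInℤ (simplest t) (simplest t ∘ doubleX)
simplest-ValuesIn-doubled t x y with simplest-even-first t x y
... | _ , y′ , (u , refl) , _ , eq = u , y′ , trans (eval-∘-doubleX (simplest t) u y′) eq

-- By definition the leading coefficient of F ∘ mat p q r s is F(p, r), so an equivalence
-- G_t = F_t ∘ γ gives F_t(p, r) = F_t(2, 0).
simplest-∘-doubleX≢ : ∀ t γ → InGL2Z γ → simplest t ∘ doubleX ≢ simplest t ∘ γ
simplest-∘-doubleX≢ t (mat p q r s) unit eq with simplest-even-first t p r
... | _ , _ , _ , inj₁ ((h , refl) , (k , refl)) , _ =
  even⇒¬odd (h * s - q * k , solve 4 (λ h k q s →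
                con (+ 2) :* h :* s :- q :* (con (+ 2) :* k) := con (+ 2) :* (h :* s :- q :* k))
              refl h k q s)
            (IsUnit⇒Odd unit)
... | _ , _ , ex′ , inj₂ oy′ , eq′ =
  even⇒¬odd
    (subst Even (trans (cong c₀ eq) (sym eq′)) (eval-even (simplest t) (1ℤ , refl) (0ℤ , refl)))
            (simplest-odd t ex′ oy′)

strictly-increasing⇒injective : ∀ {f : ℕ → ℕ} → (∀ {m n} → m ℕ.< n → f m ℕ.< f n) →
                                ∀ {m n} → f m ≡ f n → m ≡ n
strictly-increasing⇒injective increasing {m} {n} eq with ℕ.<-cmp m n
... | tri< m<n _ _ = contradiction eq (ℕ.<⇒≢ (increasing m<n))
... | tri≈ _ m≡n _ = m≡n
... | tri> _ _ n<m = contradiction (sym eq) (ℕ.<⇒≢ (increasing n<m))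

δ-increasing : ∀ {m n} → m ℕ.< n → δ m ℕ.< δ n
δ-increasing m<n = ℕ.+-mono-< (ℕ.+-monoʳ-< 9 (ℕ.*-monoʳ-< 3 m<n)) (ℕ.*-mono-< m<n m<n)

simplest-equivalent⇒≡ : ∀ m n {k γ} → InGL2Z γ →
  ι (simplest (+ n)) ≡ k Defs.· (ι (simplest (+ m)) ∘ₘ γ) → m ≡ n
simplest-equivalent⇒≡ m n {k} {γ} unit eq =
  strictly-increasing⇒injective (λ m<n → ℕ.*-mono-< (δ-increasing m<n) (δ-increasing m<n))
    (+-injective (begin
      + (δ m ℕ.* δ m)  ≡⟨ sym (disc-simplest m) ⟩
      disc Fₘ          ≡⟨ disc-unit-equivalence Fₘ Fₙ γ (c₀ W) unit c₀W-unit W≡c₀W·Fₙ ⟩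
      disc Fₙ          ≡⟨ disc-simplest n ⟩
      + (δ n ℕ.* δ n)  ∎))
  where
  open ≡-Reasoning
  Fₘ Fₙ W : Form
  Fₘ = simplest (+ m)
  Fₙ = simplest (+ n)
  W  = Fₘ ∘ γ
  W≡c₀W·Fₙ : W ≡ c₀ W · Fₙ
  W≡c₀W·Fₙ = integral-multiple {Fₙ} {W} {k} (trans eq (cong (k Defs.·_) (ι-∘ Fₘ γ))) refl
  c₀W-unit : IsUnit (c₀ W)
  c₀W-unit = ∘-multiple⇒unit Fₘ Fₙ γ (c₀ W) refl unit W≡c₀W·Fₙ

simplestPair : ℕ → Cubic × Cubic
simplestPair n = ι (simplest (+ n)) , ι (simplest (+ n) ∘ doubleX)

simplestPair-linked : ∀ n → LinkedExtraordinary (proj₁ (simplestPair n)) (proj₂ (simplestPair n))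
simplestPair-linked n =
    ι-IsBin3 F (disc-simplest≢0 n)
  , ι-IsBin3 (F ∘ doubleX) (disc-∘≢0 F doubleX (λ ()) (disc-simplest≢0 n))
  , ( ι-ValuesIn F (F ∘ doubleX) (simplest-ValuesIn-doubled (+ n))
    , ι-ValuesIn (F ∘ doubleX) F (∘-ValuesIn F doubleX))
  , λ (γ , unit , eq) → simplest-∘-doubleX≢ (+ n) γ unit (ι-injective (trans eq (ι-∘ F γ)))
  where F = simplest (+ n)

corollary1p15 : ∃ λ (f : ℕ → Cubic × Cubic) →
    (∀ n → LinkedExtraordinary (proj₁ (f n)) (proj₂ (f n)))
    × (∀ m n → m ≢ n → ¬ PairEquiv (f m) (f n))
corollary1p15 =
  simplestPair , simplestPair-linked ,
  λ m n m≢n (k , γ , _ , _ , unit , _ , eq , _) → m≢n (simplest-equivalent⇒≡ m n {k} {γ} unit eq)
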